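{- Let $G$ be a finite simple graph and $U$ a spanning subgraph of $G$. Then (i) $U$ is a fixing subgraph of $G$ if and only if $x(U;G)=\dfrac{|A(U)|}{|A(U)\cap A(G)|}$; (ii) $U$ is a strong fixing subgraph of $G$ if and only if $x(U;G)=1$; (iii) if $U$ is a strong fixing subgraph of $G$ and $K$ is a spanning subgraph of $G$ with $E(U)\subseteq E(K)$, then $A(K)\subseteq A(G)$ and $K$ is a strong fixing subgraph of $G$.
   Context: All graphs are finite and simple; a spanning subgraph of $G$ has vertex set $V(G)$ and edge set contained in $E(G)$. $A(H)$ denotes the automorphism group of $H$; for graphs on vertex set $V(G)$ these are subgroups of the symmetric group on $V(G)$. $s(U;G)$ is the number of spanning subgraphs of $G$ isomorphic to $U$. $x(U;G)$ is the number of graphs $X$ with vertex set $V(G)$ such that $E(U)\subseteq E(X)$ and $X\cong G$. A spanning subgraph $U$ of $G$ is a fixing subgraph of $G$ if $s(U;G)=|A(G)|/|A(U)\cap A(G)|$, and a strong fixing subgraph of $G$ if moreover $A(U)\subseteq A(G)$ (equivalently $s(U;G)=|A(G)|/|A(U)|$). -}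

module Defs where

open import Data.Nat using (ℕ; zero; suc; _*_)
open import Data.Bool using (Bool; true; false; _∧_; _∨_; not; T)
import Data.Bool as B
open import Data.Fin using (Fin)
import Data.Fin as F
open import Data.Vec using (Vec; []; _∷_; lookup)
open import Data.List using (List; []; _∷_; _++_; map; concatMap; length; filterᵇ; allFin)
open import Data.Bool.ListAction using (all; any)
open import Relation.Nullary.Decidable using (⌊_⌋)

-- Graphs on the vertex set Fin n, given by an n×n Boolean adjacency matrix.
Mat : ℕ → Set
Mat n = Vec (Vec Bool n) n

adj : ∀ {n} → Mat n → Fin n → Fin n → Bool
adj M i j = lookup (lookup M i) j

_=ᵇ_ : Bool → Bool → Bool
a =ᵇ b = ⌊ a B.≟ b ⌋

_=ᶠ_ : ∀ {n} → Fin n → Fin n → Bool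
i =ᶠ j = ⌊ i F.≟ j ⌋

_⇒ᵇ_ : Bool → Bool → Bool
a ⇒ᵇ b = not a ∨ b

∀²ᵇ : ∀ {n} → (Fin n → Fin n → Bool) → Bool
∀²ᵇ {n} p = all (λ i → all (λ j → p i j) (allFin n)) (allFin n)

isSimple : ∀ {n} → Mat n → Bool
isSimple M = ∀²ᵇ (λ i j → adj M i j =ᵇ adj M j i) ∧ ∀²ᵇ (λ i j → (i =ᶠ j) ⇒ᵇ not (adj M i j))

edgeSub : ∀ {n} → Mat n → Mat n → Bool
edgeSub H K = ∀²ᵇ (λ i j → adj H i j ⇒ᵇ adj K i j)

Map : ℕ → Set
Map n = Vec (Fin n) n

-- σ is a permutation of V (injective, hence bijective on a finite set)
isPerm : ∀ {n} → Map n → Bool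
isPerm σ = ∀²ᵇ (λ i j → (lookup σ i =ᶠ lookup σ j) ⇒ᵇ (i =ᶠ j))

-- σ is an automorphism of H (given that σ is a permutation)
isAut : ∀ {n} → Mat n → Map n → Bool
isAut H σ = ∀²ᵇ (λ i j → adj H (lookup σ i) (lookup σ j) =ᵇ adj H i j)

allVecs : ∀ {A : Set} → List A → (m : ℕ) → List (Vec A m)
allVecs xs zero = [] ∷ []
allVecs xs (suc m) = concatMap (λ x → map (x ∷_) (allVecs xs m)) xs

allMaps : (n : ℕ) → List (Map n)
allMaps n = allVecs (allFin n) n

allPerms : (n : ℕ) → List (Map n)
allPerms n = filterᵇ isPerm (allMaps n)

allGraphs : (n : ℕ) → List (Mat n)
allGraphs n = filterᵇ isSimple (allVecs (allVecs (true ∷ false ∷ []) n) n)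

isoᵇ : ∀ {n} → Mat n → Mat n → Bool
isoᵇ {n} X Y = any (λ σ → ∀²ᵇ (λ i j → adj X (lookup σ i) (lookup σ j) =ᵇ adj Y i j)) (allPerms n)

count : ∀ {A : Set} → (A → Bool) → List A → ℕ
count p xs = length (filterᵇ p xs)

autCount : ∀ {n} → Mat n → ℕ
autCount {n} H = count (isAut H) (allPerms n)

autCapCount : ∀ {n} → Mat n → Mat n → ℕ
autCapCount {n} U G = count (λ σ → isAut U σ ∧ isAut G σ) (allPerms n)

sCount : ∀ {n} → Mat n → Mat n → ℕ
sCount {n} U G = count (λ H → edgeSub H G ∧ isoᵇ H U) (allGraphs n)

xCount : ∀ {n} → Mat n → Mat n → ℕ
xCount {n} U G = count (λ X → edgeSub U X ∧ isoᵇ X G) (allGraphs n)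

AutSub : ∀ {n} → Mat n → Mat n → Set
AutSub {n} H K = (σ : Map n) → T (isPerm σ) → T (isAut H σ) → T (isAut K σ)

-- Fixing subgraph: s(U;G) = |A(G)| / |A(U) ∩ A(G)|  (denominators cleared)
Fixing : ∀ {n} → Mat n → Mat n → Set
Fixing U G = sCount U G * autCapCount U G ≡ autCount G
  where open import Relation.Binary.PropositionalEquality using (_≡_)

StrongFixing : ∀ {n} → Mat n → Mat n → Set
StrongFixing U G = Fixing U G × AutSub U G
  where open import Data.Product using (_×_)

-- Count the permutations τ of the vertices with E(U) ⊆ E(τ*G), where τ*G is G relabelled by τ.
-- Grouped by the graph τ*G, every X ≅ G with E(U) ⊆ E(X) arises from exactly |A(G)| of them, so
-- there are x(U;G)·|A(G)|. Inversion τ ↦ τ⁻¹ matches them with the ρ having E(ρ*U) ⊆ E(G), and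
-- grouped by ρ*U these number s(U;G)·|A(U)|. So x(U;G)·|A(G)| = s(U;G)·|A(U)|, and (i) is
-- cross-multiplication. In (ii), A(U) ⊆ A(G) gives |A(U) ∩ A(G)| = |A(U)|, hence x(U;G) = 1;
-- conversely, if x(U;G) = 1 then for σ ∈ A(U) the graph σ*G ⊇ σ*U = U is isomorphic to G, so
-- σ*G = G. For (iii), x(K;G) ≤ x(U;G) = 1 while G itself is counted by x(K;G).

module Submission where

open import Defs
open import Data.Bool using (Bool; true; false; _∧_; not; T; T?)
open import Data.Bool.Instances
open import Data.Bool.ListAction using (all)
open import Data.Bool.Properties using (T-∧)
open import Data.Fin using (Fin; zero; suc; punchOut)
open import Data.Fin.Instances
import Data.Fin.Properties as Fin
open import Data.List using (List; []; _∷_; _++_; map; concatMap; length; filterᵇ; allFin)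
open import Data.List.Membership.Propositional using (_∈_; find; lose)
open import Data.List.Membership.Propositional.Properties using (∈-filter⁺; ∈-filter⁻; ∈-allFin)
open import Data.List.Properties using (filter-++; length-++; map-tabulate)
import Data.List.Relation.Unary.All as All
open import Data.List.Relation.Unary.All.Properties using (all⁺; all⁻)
open import Data.List.Relation.Unary.Any using (here; there)
open import Data.List.Relation.Unary.Any.Properties using (any⁺; any⁻)
open import Data.Nat using (ℕ; zero; suc; _+_; _*_; _≤_; z≤n; s≤s; NonZero; >-nonZero)
open import Data.Nat.Properties
  using (+-identityʳ; *-identityˡ; *-identityʳ; *-distribʳ-+; *-comm; *-cancelʳ-≡; ≤-antisym; m≤n⇒m≤1+n; 1+n≰n;
         +-commutativeSemigroup; *-commutativeSemigroup)
open import Algebra.Properties.CommutativeSemigroup +-commutativeSemigroup using (interchange)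
open import Algebra.Properties.CommutativeSemigroup *-commutativeSemigroup using (xy∙z≈xz∙y)
open import Data.Product using (_×_; _,_; proj₁; proj₂; ∃)
open import Data.Vec using (Vec; []; _∷_; lookup; tabulate)
open import Data.Vec.Instances
import Data.Vec.Properties as Vec
open import Function using (id; _∘_; _⇔_; mk⇔; Equivalence)
open import Function.Definitions using (Injective)
open import Relation.Binary.PropositionalEquality
open import Relation.Binary.Structures using (IsDecEquivalence)
open import Relation.Binary.TypeClasses using (_≟_)
open import Relation.Nullary using (¬_; yes; no; contradiction)
open import Relation.Nullary.Decidable using (⌊_⌋; toWitness; fromWitness)

open Equivalence

∧-implied : ∀ a b c → (T c → T b) → T ((a ∧ b) ∧ c) ⇔ T (a ∧ c)
∧-implied false b c c⇒b = mk⇔ id id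
∧-implied true true c c⇒b = mk⇔ id id
∧-implied true false false c⇒b = mk⇔ id id
∧-implied true false true c⇒b = mk⇔ (λ ()) c⇒b

T-∧ˡ : ∀ a {b} → T (a ∧ b) → T a
T-∧ˡ a = proj₁ ∘ T-∧ .to

T-∧ʳ : ∀ a {b} → T (a ∧ b) → T b
T-∧ʳ a = proj₂ ∘ T-∧ {a} .to

T-∀²ᵇ : ∀ {n} (p : Fin n → Fin n → Bool) → T (∀²ᵇ p) ⇔ (∀ i j → T (p i j))
T-∀²ᵇ {n} p = mk⇔
  (λ t i j → All.lookup (all⁺ (p i) (allFin n) (All.lookup (all⁺ _ (allFin n) t) (∈-allFin i))) (∈-allFin j))
  (λ h → all⁻ (λ i → all (p i) (allFin n)) {xs = allFin n}
           (All.tabulate λ {i} _ → all⁻ (p i) {xs = allFin n} (All.tabulate λ {j} _ → h i j)))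

T-=ᵇ : {a b : Bool} → T (a =ᵇ b) ⇔ a ≡ b
T-=ᵇ = mk⇔ toWitness fromWitness

T-=ᶠ : ∀ {n} {i j : Fin n} → T (i =ᶠ j) ⇔ i ≡ j
T-=ᶠ = mk⇔ toWitness fromWitness

T-⇒ᵇ : {a b : Bool} → T (a ⇒ᵇ b) ⇔ (T a → T b)
T-⇒ᵇ {true} = mk⇔ (λ t _ → t) (λ f → f _)
T-⇒ᵇ {false} = mk⇔ (λ _ ()) (λ _ → _)

-- Counting over lists

⟦_⟧ : Bool → ℕ
⟦ true ⟧ = 1
⟦ false ⟧ = 0

∑ : {A : Set} → (A → ℕ) → List A → ℕ
∑ f [] = 0
∑ f (x ∷ xs) = f x + ∑ f xs

module _ {A : Set} where

  ∑-cong : {f g : A → ℕ} → (∀ x → f x ≡ g x) → (xs : List A) → ∑ f xs ≡ ∑ g xs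
  ∑-cong f≗g [] = refl
  ∑-cong f≗g (x ∷ xs) = cong₂ _+_ (f≗g x) (∑-cong f≗g xs)

  ∑-zero : (xs : List A) → ∑ (λ _ → 0) xs ≡ 0
  ∑-zero [] = refl
  ∑-zero (x ∷ xs) = ∑-zero xs

  ∑-+ : (f g : A → ℕ) (xs : List A) → ∑ (λ x → f x + g x) xs ≡ ∑ f xs + ∑ g xs
  ∑-+ f g [] = refl
  ∑-+ f g (x ∷ xs) = trans (cong (f x + g x +_) (∑-+ f g xs)) (interchange (f x) (g x) (∑ f xs) (∑ g xs))

  count-∷ : (r : A → Bool) (x : A) (xs : List A) → count r (x ∷ xs) ≡ ⟦ r x ⟧ + count r xs
  count-∷ r x xs with r x
  ... | true = refl
  ... | false = refl

  count≡∑ : (r : A → Bool) (xs : List A) → count r xs ≡ ∑ (λ x → ⟦ r x ⟧) xs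
  count≡∑ r [] = refl
  count≡∑ r (x ∷ xs) = trans (count-∷ r x xs) (cong (⟦ r x ⟧ +_) (count≡∑ r xs))

  ∑-indicator-* : (r : A → Bool) (c : ℕ) (xs : List A) → ∑ (λ x → ⟦ r x ⟧ * c) xs ≡ count r xs * c
  ∑-indicator-* r c [] = refl
  ∑-indicator-* r c (x ∷ xs) = begin
    ⟦ r x ⟧ * c + ∑ (λ x → ⟦ r x ⟧ * c) xs ≡⟨ cong (⟦ r x ⟧ * c +_) (∑-indicator-* r c xs) ⟩
    ⟦ r x ⟧ * c + count r xs * c            ≡⟨ sym (*-distribʳ-+ c ⟦ r x ⟧ (count r xs)) ⟩
    (⟦ r x ⟧ + count r xs) * c              ≡⟨ cong (_* c) (sym (count-∷ r x xs)) ⟩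
    count r (x ∷ xs) * c                    ∎
    where open ≡-Reasoning

  count-none : (r : A → Bool) (xs : List A) → (∀ x → ¬ T (r x)) → count r xs ≡ 0
  count-none r [] never = refl
  count-none r (x ∷ xs) never with r x in rx
  ... | true = contradiction (subst T (sym rx) _) (never x)
  ... | false = count-none r xs never

  count-++ : (r : A → Bool) (xs ys : List A) → count r (xs ++ ys) ≡ count r xs + count r ys
  count-++ r xs ys = trans (cong length (filter-++ (T? ∘ r) xs ys)) (length-++ (filterᵇ r xs))

  count-filter : (q r : A → Bool) (xs : List A) → count r (filterᵇ q xs) ≡ count (λ x → q x ∧ r x) xs
  count-filter q r [] = refl
  count-filter q r (x ∷ xs) with q x
  ... | false = count-filter q r xs
  ... | true with r x
  ...   | true = cong suc (count-filter q r xs)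
  ...   | false = count-filter q r xs

  count-mono : {r r′ : A → Bool} (xs : List A) → (∀ {x} → x ∈ xs → T (r x) → T (r′ x)) → count r xs ≤ count r′ xs
  count-mono [] r⇒r′ = z≤n
  count-mono {r} {r′} (x ∷ xs) r⇒r′ with r x in rx | r′ x in r′x
  ... | true | true = s≤s (count-mono xs (r⇒r′ ∘ there))
  ... | true | false = contradiction (subst T r′x (r⇒r′ (here refl) (subst T (sym rx) _))) λ ()
  ... | false | true = m≤n⇒m≤1+n (count-mono xs (r⇒r′ ∘ there))
  ... | false | false = count-mono xs (r⇒r′ ∘ there)

  count-cong : {r r′ : A → Bool} (xs : List A) → (∀ {x} → x ∈ xs → T (r x) ⇔ T (r′ x)) → count r xs ≡ count r′ xs
  count-cong xs r⇔r′ = ≤-antisym (count-mono xs (λ x∈ → r⇔r′ x∈ .to)) (count-mono xs (λ x∈ → r⇔r′ x∈ .from))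

  count-pos : (r : A → Bool) {x : A} {xs : List A} → x ∈ xs → T (r x) → 1 ≤ count r xs
  count-pos r x∈xs rx = nonempty (∈-filter⁺ (T? ∘ r) x∈xs rx)
    where
    nonempty : ∀ {x ys} → x ∈ ys → 1 ≤ length ys
    nonempty (here _) = s≤s z≤n
    nonempty (there _) = s≤s z≤n

  count≡1⇒unique : (r : A → Bool) {x y : A} {xs : List A} → count r xs ≡ 1 →
                   x ∈ xs → y ∈ xs → T (r x) → T (r y) → x ≡ y
  count≡1⇒unique r {xs = xs} one x∈xs y∈xs rx ry
    with filterᵇ r xs | ∈-filter⁺ (T? ∘ r) x∈xs rx | ∈-filter⁺ (T? ∘ r) y∈xs ry
  ... | _ ∷ [] | here x≡z | here y≡z = trans x≡z (sym y≡z)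

module _ {A B : Set} where

  count-map : (r : B → Bool) (f : A → B) (xs : List A) → count r (map f xs) ≡ count (r ∘ f) xs
  count-map r f [] = refl
  count-map r f (x ∷ xs) = trans (count-∷ r (f x) (map f xs))
    (trans (cong (⟦ r (f x) ⟧ +_) (count-map r f xs)) (sym (count-∷ (r ∘ f) x xs)))

  count-concatMap : (r : B → Bool) (g : A → List B) (xs : List A) → count r (concatMap g xs) ≡ ∑ (λ x → count r (g x)) xs
  count-concatMap r g [] = refl
  count-concatMap r g (x ∷ xs) = trans (count-++ r (g x) (concatMap g xs)) (cong (count r (g x) +_) (count-concatMap r g xs))

-- Enumerations

module _ {A : Set} {{_ : IsDecEquivalence {A = A} _≡_}} where

  _==_ : A → A → Bool
  a == b = ⌊ a ≟ b ⌋

  T-== : {a b : A} → T (a == b) ⇔ a ≡ b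
  T-== = mk⇔ toWitness fromWitness

  record Enumerates (xs : List A) : Set where
    field occurs-once : ∀ a → count (a ==_) xs ≡ 1
  open Enumerates public

  ∈-enumeration : {xs : List A} → Enumerates xs → ∀ a → a ∈ xs
  ∈-enumeration {xs} enum a with filterᵇ (a ==_) xs in eq | enum .occurs-once a
  ... | z ∷ [] | _ with ∈-filter⁻ (T? ∘ (a ==_)) {xs = xs} (subst (z ∈_) (sym eq) (here refl))
  ...   | z∈xs , a==z = subst (_∈ xs) (sym (T-== .to a==z)) z∈xs

  count-unique : (r : A → Bool) {xs : List A} → Enumerates xs → {a : A} → T (r a) →
                 (∀ b → T (r b) → b ≡ a) → count r xs ≡ 1
  count-unique r {xs} enum {a} ra unique = trans (count-cong xs r⇔a==) (enum .occurs-once a)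
    where
    r⇔a== : ∀ {b} → b ∈ xs → T (r b) ⇔ T (a == b)
    r⇔a== _ = mk⇔ (λ rb → T-== .from (sym (unique _ rb))) (λ a==b → subst (T ∘ r) (T-== .to a==b) ra)

  count-fibres : {X : Set} (xs : List X) {ys : List A} → Enumerates ys →
                 (f : X → A) (p : X → Bool) (q : A → Bool) (c : ℕ) →
                 (∀ x → T (p x) → T (q (f x))) →
                 (∀ b → T (q b) → count (λ x → p x ∧ f x == b) xs ≡ c) →
                 count p xs ≡ count q ys * c
  count-fibres {X} xs {ys} enum f p q c p⇒q fibre-count = begin
    count p xs                          ≡⟨ count-by-fibres xs ⟩
    ∑ (λ b → count (fibre b) xs) ys     ≡⟨ ∑-cong fibre-size ys ⟩
    ∑ (λ b → ⟦ q b ⟧ * c) ys            ≡⟨ ∑-indicator-* q c ys ⟩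
    count q ys * c                      ∎
    where
    open ≡-Reasoning
    fibre : A → X → Bool
    fibre b x = p x ∧ f x == b

    ∑-fibres-at : ∀ x → ∑ (λ b → ⟦ fibre b x ⟧) ys ≡ ⟦ p x ⟧
    ∑-fibres-at x with p x
    ... | true = trans (sym (count≡∑ (f x ==_) ys)) (enum .occurs-once (f x))
    ... | false = ∑-zero ys

    count-by-fibres : (xs : List X) → count p xs ≡ ∑ (λ b → count (fibre b) xs) ys
    count-by-fibres [] = sym (∑-zero ys)
    count-by-fibres (x ∷ xs) = begin
      count p (x ∷ xs)                                           ≡⟨ count-∷ p x xs ⟩
      ⟦ p x ⟧ + count p xs                                       ≡⟨ cong₂ _+_ (sym (∑-fibres-at x)) (count-by-fibres xs) ⟩
      ∑ (λ b → ⟦ fibre b x ⟧) ys + ∑ (λ b → count (fibre b) xs) ys ≡⟨ sym (∑-+ _ _ ys) ⟩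
      ∑ (λ b → ⟦ fibre b x ⟧ + count (fibre b) xs) ys           ≡⟨ ∑-cong (λ b → sym (count-∷ (fibre b) x xs)) ys ⟩
      ∑ (λ b → count (fibre b) (x ∷ xs)) ys                      ∎

    fibre-size : ∀ b → count (fibre b) xs ≡ ⟦ q b ⟧ * c
    fibre-size b with q b in qb
    ... | true = trans (fibre-count b (subst T (sym qb) _)) (sym (+-identityʳ c))
    ... | false = count-none (fibre b) xs λ x fibre-b-x →
      let px , fx==b = T-∧ .to fibre-b-x
      in subst T qb (subst (T ∘ q) (T-== .to fx==b) (p⇒q x px))

module _ {X A : Set} {{_ : IsDecEquivalence {A = X} _≡_}} {{_ : IsDecEquivalence {A = A} _≡_}} where

  T-==-cong : {f : X → A} → (∀ {x y} → f x ≡ f y → x ≡ y) → ∀ {x y} → T (f x == f y) ⇔ T (x == y)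
  T-==-cong f-injective = mk⇔ (λ t → T-== .from (f-injective (T-== .to t))) (λ t → T-== .from (cong _ (T-== .to t)))

  count-bijection : {xs : List X} {ys : List A} → Enumerates xs → Enumerates ys →
                    (p : X → Bool) (q : A → Bool) (f : X → A) (g : A → X) →
                    (∀ x → T (p x) → T (q (f x))) → (∀ y → T (q y) → T (p (g y))) →
                    (∀ x → T (p x) → g (f x) ≡ x) → (∀ y → T (q y) → f (g y) ≡ y) →
                    count p xs ≡ count q ys
  count-bijection {xs} enum-xs enum-ys p q f g p⇒q q⇒p gf≡id fg≡id =
    trans (count-fibres xs enum-ys f p q 1 p⇒q single-preimage) (*-identityʳ _)
    where
    single-preimage : ∀ y → T (q y) → count (λ x → p x ∧ f x == y) xs ≡ 1
    single-preimage y qy = count-unique _ enum-xs (T-∧ .from (q⇒p y qy , T-== .from (fg≡id y qy))) λ x t →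
      let px , fx==y = T-∧ .to t
      in trans (sym (gf≡id x px)) (cong g (T-== .to fx==y))

bools-enumerate : Enumerates (true ∷ false ∷ [])
bools-enumerate .occurs-once true = refl
bools-enumerate .occurs-once false = refl

allFin-enumerates : ∀ n → Enumerates (allFin n)
allFin-enumerates (suc n) .occurs-once i = begin
  count (i ==_) (allFin (suc n))                   ≡⟨ cong (λ js → count (i ==_) (zero ∷ js)) (sym (map-tabulate id suc)) ⟩
  count (i ==_) (zero ∷ map suc (allFin n))        ≡⟨ count-∷ (i ==_) zero _ ⟩
  ⟦ i == zero ⟧ + count (i ==_) (map suc (allFin n)) ≡⟨ cong (⟦ i == zero ⟧ +_) (count-map (i ==_) suc (allFin n)) ⟩
  ⟦ i == zero ⟧ + count (λ j → i == suc j) (allFin n) ≡⟨ occurs i ⟩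
  1                                                ∎
  where
  open ≡-Reasoning
  occurs : ∀ i → ⟦ i == zero ⟧ + count (λ j → i == suc j) (allFin n) ≡ 1
  occurs zero = cong suc (count-none _ (allFin n) λ j t → Fin.0≢1+n {i = j} (T-== .to t))
  occurs (suc i) = trans (count-cong (allFin n) (λ _ → T-==-cong Fin.suc-injective)) (allFin-enumerates n .occurs-once i)

allVecs-enumerates : {A : Set} {{_ : IsDecEquivalence {A = A} _≡_}} {xs : List A} →
                     Enumerates xs → ∀ m → Enumerates (allVecs xs m)
allVecs-enumerates enum zero .occurs-once [] = refl
allVecs-enumerates {xs = xs} enum (suc m) .occurs-once (a ∷ w) = begin
  count ((a ∷ w) ==_) (allVecs xs (suc m))         ≡⟨ count-concatMap _ (λ x → map (x ∷_) vs) xs ⟩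
  ∑ (λ x → count ((a ∷ w) ==_) (map (x ∷_) vs)) xs ≡⟨ ∑-cong (λ x → count-map _ (x ∷_) vs) xs ⟩
  ∑ (λ x → count (λ v → (a ∷ w) == (x ∷ v)) vs) xs ≡⟨ ∑-cong heads xs ⟩
  ∑ (λ x → ⟦ a == x ⟧) xs                          ≡⟨ sym (count≡∑ (a ==_) xs) ⟩
  count (a ==_) xs                                 ≡⟨ enum .occurs-once a ⟩
  1                                                ∎
  where
  open ≡-Reasoning
  vs = allVecs xs m
  heads : ∀ x → count (λ v → (a ∷ w) == (x ∷ v)) vs ≡ ⟦ a == x ⟧
  heads x with a == x in a==x
  ... | true = trans (count-cong vs λ _ → tails-agree) (allVecs-enumerates enum m .occurs-once w)
    where
    a≡x = T-== .to (subst T (sym a==x) _)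
    tails-agree : ∀ {v} → T ((a ∷ w) == (x ∷ v)) ⇔ T (w == v)
    tails-agree = mk⇔ (λ t → T-== .from (Vec.∷-injectiveʳ (T-== .to t)))
                      (λ t → T-== .from (cong₂ _∷_ a≡x (T-== .to t)))
  ... | false = count-none _ vs λ v t → subst T a==x (T-== .from (Vec.∷-injectiveˡ (T-== .to t)))

-- Permutations of Fin n and relabelled graphs

Vec-ext : ∀ {A : Set} {n} {u v : Vec A n} → (∀ i → lookup u i ≡ lookup v i) → u ≡ v
Vec-ext {u = u} {v} u≗v = begin
  u                   ≡⟨ Vec.tabulate∘lookup u ⟨
  tabulate (lookup u) ≡⟨ Vec.tabulate-cong u≗v ⟩
  tabulate (lookup v) ≡⟨ Vec.tabulate∘lookup v ⟩
  v                   ∎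
  where open ≡-Reasoning

injective⇒surjective : ∀ {m} {f : Fin m → Fin m} → Injective _≡_ _≡_ f → ∀ j → ∃ λ i → f i ≡ j
injective⇒surjective {suc m} {f} f-injective j with Fin.any? (λ i → f i Fin.≟ j)
... | yes hit = hit
... | no miss = contradiction (Fin.injective⇒≤ punchOut∘f-injective) 1+n≰n
  where
  j≢f : ∀ i → j ≢ f i
  j≢f i j≡fi = miss (i , sym j≡fi)
  punchOut∘f : Fin (suc m) → Fin m
  punchOut∘f i = punchOut (j≢f i)
  punchOut∘f-injective : Injective _≡_ _≡_ punchOut∘f
  punchOut∘f-injective {x} {y} = f-injective ∘ Fin.punchOut-injective (j≢f x) (j≢f y)

allMatrices : (n : ℕ) → List (Mat n)
allMatrices n = allVecs (allVecs (true ∷ false ∷ []) n) n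

module _ {n : ℕ} where

  T-isPerm : (σ : Map n) → T (isPerm σ) ⇔ Injective _≡_ _≡_ (lookup σ)
  T-isPerm σ = mk⇔
    (λ t {i} {j} σi≡σj → T-=ᶠ .to (T-⇒ᵇ .to (T-∀²ᵇ injective-at .to t i j) (T-=ᶠ .from σi≡σj)))
    (λ σ-injective → T-∀²ᵇ injective-at .from λ i j → T-⇒ᵇ .from λ t → T-=ᶠ .from (σ-injective (T-=ᶠ .to t)))
    where
    injective-at : Fin n → Fin n → Bool
    injective-at i j = (lookup σ i =ᶠ lookup σ j) ⇒ᵇ (i =ᶠ j)

  _∘ᵐ_ : Map n → Map n → Map n
  σ ∘ᵐ τ = tabulate (lookup σ ∘ lookup τ)

  idᵐ : Map n
  idᵐ = tabulate id

  lookup-∘ᵐ : ∀ σ τ i → lookup (σ ∘ᵐ τ) i ≡ lookup σ (lookup τ i)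
  lookup-∘ᵐ σ τ = Vec.lookup∘tabulate (lookup σ ∘ lookup τ)

  lookup-idᵐ : ∀ i → lookup idᵐ i ≡ i
  lookup-idᵐ = Vec.lookup∘tabulate id

  idᵐ-injective : Injective _≡_ _≡_ (lookup idᵐ)
  idᵐ-injective {i} {j} eq = trans (sym (lookup-idᵐ i)) (trans eq (lookup-idᵐ j))

  ∘ᵐ-injective : ∀ σ τ → Injective _≡_ _≡_ (lookup σ) → Injective _≡_ _≡_ (lookup τ) →
                 Injective _≡_ _≡_ (lookup (σ ∘ᵐ τ))
  ∘ᵐ-injective σ τ σ-injective τ-injective {i} {j} eq =
    τ-injective (σ-injective (trans (sym (lookup-∘ᵐ σ τ i)) (trans eq (lookup-∘ᵐ σ τ j))))

  ∘ᵐ-cancelʳ : ∀ τ ρ ρ′ → (∀ i → lookup ρ (lookup ρ′ i) ≡ i) → (τ ∘ᵐ ρ) ∘ᵐ ρ′ ≡ τ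
  ∘ᵐ-cancelʳ τ ρ ρ′ ρρ′≗id = Vec-ext λ i → begin
    lookup ((τ ∘ᵐ ρ) ∘ᵐ ρ′) i         ≡⟨ lookup-∘ᵐ (τ ∘ᵐ ρ) ρ′ i ⟩
    lookup (τ ∘ᵐ ρ) (lookup ρ′ i)     ≡⟨ lookup-∘ᵐ τ ρ _ ⟩
    lookup τ (lookup ρ (lookup ρ′ i)) ≡⟨ cong (lookup τ) (ρρ′≗id i) ⟩
    lookup τ i                        ∎
    where open ≡-Reasoning

  -- For a non-injective σ the value is junk; only injective σ are ever inverted.
  preimage : Map n → Fin n → Fin n
  preimage σ j with Fin.any? (λ i → lookup σ i Fin.≟ j)
  ... | yes (i , _) = i
  ... | no _ = j

  inverse : Map n → Map n
  inverse σ = tabulate (preimage σ)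

  module _ (σ : Map n) (σ-injective : Injective _≡_ _≡_ (lookup σ)) where

    inverse-rightInverse : ∀ j → lookup σ (lookup (inverse σ) j) ≡ j
    inverse-rightInverse j rewrite Vec.lookup∘tabulate (preimage σ) j
      with Fin.any? (λ i → lookup σ i Fin.≟ j)
    ... | yes (_ , σi≡j) = σi≡j
    ... | no miss = contradiction (injective⇒surjective σ-injective j) miss

    inverse-leftInverse : ∀ i → lookup (inverse σ) (lookup σ i) ≡ i
    inverse-leftInverse i = σ-injective (inverse-rightInverse (lookup σ i))

    inverse-injective : Injective _≡_ _≡_ (lookup (inverse σ))
    inverse-injective {i} {j} eq = begin
      i                               ≡⟨ inverse-rightInverse i ⟨
      lookup σ (lookup (inverse σ) i) ≡⟨ cong (lookup σ) eq ⟩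
      lookup σ (lookup (inverse σ) j) ≡⟨ inverse-rightInverse j ⟩
      j                               ∎
      where open ≡-Reasoning

  inverse-involutive : ∀ σ → Injective _≡_ _≡_ (lookup σ) → inverse (inverse σ) ≡ σ
  inverse-involutive σ σ-injective = Vec-ext λ i → inverse-injective σ σ-injective (begin
    lookup (inverse σ) (lookup (inverse (inverse σ)) i) ≡⟨ inverse-rightInverse (inverse σ) (inverse-injective σ σ-injective) i ⟩
    i                                                   ≡⟨ inverse-leftInverse σ σ-injective i ⟨
    lookup (inverse σ) (lookup σ i)                     ∎)
    where open ≡-Reasoning

  pullback : Map n → Mat n → Mat n
  pullback σ X = tabulate λ i → tabulate λ j → adj X (lookup σ i) (lookup σ j)

  adj-pullback : ∀ σ X i j → adj (pullback σ X) i j ≡ adj X (lookup σ i) (lookup σ j)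
  adj-pullback σ X i j = trans (cong (λ row → lookup row j) (Vec.lookup∘tabulate _ i)) (Vec.lookup∘tabulate _ j)

  Mat-ext : {M N : Mat n} → (∀ i j → adj M i j ≡ adj N i j) → M ≡ N
  Mat-ext M≗N = Vec-ext λ i → Vec-ext (M≗N i)

  pullback-idᵐ : ∀ X → pullback idᵐ X ≡ X
  pullback-idᵐ X = Mat-ext λ i j → trans (adj-pullback idᵐ X i j) (cong₂ (adj X) (lookup-idᵐ i) (lookup-idᵐ j))

  pullback-∘ᵐ : ∀ σ τ X → pullback (σ ∘ᵐ τ) X ≡ pullback τ (pullback σ X)
  pullback-∘ᵐ σ τ X = Mat-ext λ i j → begin
    adj (pullback (σ ∘ᵐ τ) X) i j                         ≡⟨ adj-pullback (σ ∘ᵐ τ) X i j ⟩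
    adj X (lookup (σ ∘ᵐ τ) i) (lookup (σ ∘ᵐ τ) j)         ≡⟨ cong₂ (adj X) (lookup-∘ᵐ σ τ i) (lookup-∘ᵐ σ τ j) ⟩
    adj X (lookup σ (lookup τ i)) (lookup σ (lookup τ j)) ≡⟨ adj-pullback σ X _ _ ⟨
    adj (pullback σ X) (lookup τ i) (lookup τ j)          ≡⟨ adj-pullback τ (pullback σ X) i j ⟨
    adj (pullback τ (pullback σ X)) i j                   ∎
    where open ≡-Reasoning

  pullback-inverse : ∀ σ → Injective _≡_ _≡_ (lookup σ) → ∀ X → pullback (inverse σ) (pullback σ X) ≡ X
  pullback-inverse σ σ-injective X = Mat-ext λ i j → begin
    adj (pullback (inverse σ) (pullback σ X)) i j                 ≡⟨ cong (λ M → adj M i j) (pullback-∘ᵐ σ (inverse σ) X) ⟨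
    adj (pullback (σ ∘ᵐ inverse σ) X) i j                         ≡⟨ adj-pullback (σ ∘ᵐ inverse σ) X i j ⟩
    adj X (lookup (σ ∘ᵐ inverse σ) i) (lookup (σ ∘ᵐ inverse σ) j) ≡⟨ cong₂ (adj X) (σσ⁻¹ i) (σσ⁻¹ j) ⟩
    adj X i j                                                     ∎
    where
    open ≡-Reasoning
    σσ⁻¹ : ∀ i → lookup (σ ∘ᵐ inverse σ) i ≡ i
    σσ⁻¹ i = trans (lookup-∘ᵐ σ (inverse σ) i) (inverse-rightInverse σ σ-injective i)

  T-pullback≡ : ∀ σ X Y → T (∀²ᵇ (λ i j → adj X (lookup σ i) (lookup σ j) =ᵇ adj Y i j)) ⇔ pullback σ X ≡ Y
  T-pullback≡ σ X Y = mk⇔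
    (λ t → Mat-ext λ i j → trans (adj-pullback σ X i j) (T-=ᵇ .to (T-∀²ᵇ _ .to t i j)))
    (λ eq → T-∀²ᵇ _ .from λ i j → T-=ᵇ .from (trans (sym (adj-pullback σ X i j)) (cong (λ M → adj M i j) eq)))

  T-isAut : ∀ H σ → T (isAut H σ) ⇔ pullback σ H ≡ H
  T-isAut H σ = T-pullback≡ σ H H

  allMaps-enumerates : Enumerates (allMaps n)
  allMaps-enumerates = allVecs-enumerates (allFin-enumerates n) n

  ∈-allPerms : ∀ σ → T (isPerm σ) → σ ∈ allPerms n
  ∈-allPerms σ σ-perm = ∈-filter⁺ (T? ∘ isPerm) (∈-enumeration allMaps-enumerates σ) σ-perm

  matrices-enumerate : Enumerates (allMatrices n)
  matrices-enumerate = allVecs-enumerates (allVecs-enumerates bools-enumerate n) n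

  ∈-allGraphs : ∀ X → T (isSimple X) → X ∈ allGraphs n
  ∈-allGraphs X X-simple = ∈-filter⁺ (T? ∘ isSimple) (∈-enumeration matrices-enumerate X) X-simple

  T-isoᵇ : ∀ X Y → T (isoᵇ X Y) ⇔ ∃ λ σ → T (isPerm σ) × pullback σ X ≡ Y
  T-isoᵇ X Y = mk⇔ iso⇒perm perm⇒iso
    where
    iso⇒perm : T (isoᵇ X Y) → ∃ λ σ → T (isPerm σ) × pullback σ X ≡ Y
    iso⇒perm t with find (any⁻ _ (allPerms n) t)
    ... | σ , σ∈perms , σX≡Y =
      σ , proj₂ (∈-filter⁻ (T? ∘ isPerm) {xs = allMaps n} σ∈perms) , T-pullback≡ σ X Y .to σX≡Y
    perm⇒iso : (∃ λ σ → T (isPerm σ) × pullback σ X ≡ Y) → T (isoᵇ X Y)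
    perm⇒iso (σ , σ-perm , σX≡Y) = any⁺ _ (lose (∈-allPerms σ σ-perm) (T-pullback≡ σ X Y .from σX≡Y))

  T-edgeSub : ∀ H K → T (edgeSub H K) ⇔ (∀ i j → T (adj H i j) → T (adj K i j))
  T-edgeSub H K = mk⇔ (λ t i j → T-⇒ᵇ .to (T-∀²ᵇ edge-in .to t i j))
                      (λ H⊆K → T-∀²ᵇ edge-in .from λ i j → T-⇒ᵇ .from (H⊆K i j))
    where
    edge-in : Fin n → Fin n → Bool
    edge-in i j = adj H i j ⇒ᵇ adj K i j

  edgeSub-trans : ∀ H K L → T (edgeSub H K) → T (edgeSub K L) → T (edgeSub H L)
  edgeSub-trans H K L H⊆K K⊆L =
    T-edgeSub H L .from λ i j → T-edgeSub K L .to K⊆L i j ∘ T-edgeSub H K .to H⊆K i j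

  pullback-edgeSub : ∀ σ H K → T (edgeSub H K) → T (edgeSub (pullback σ H) (pullback σ K))
  pullback-edgeSub σ H K H⊆K = T-edgeSub (pullback σ H) (pullback σ K) .from λ i j →
    subst T (sym (adj-pullback σ K i j)) ∘ T-edgeSub H K .to H⊆K (lookup σ i) (lookup σ j) ∘ subst T (adj-pullback σ H i j)

  pullback-simple : ∀ σ X → T (isSimple X) → T (isSimple (pullback σ X))
  pullback-simple σ X X-simple = T-∧ .from (T-∀²ᵇ _ .from symmetric , T-∀²ᵇ _ .from irreflexive)
    where
    X-symmetric = proj₁ (T-∧ .to X-simple)
    X-irreflexive = proj₂ (T-∧ .to X-simple)
    σX = pullback σ X

    symmetric : ∀ i j → T (adj σX i j =ᵇ adj σX j i)
    symmetric i j = T-=ᵇ .from (begin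
      adj σX i j                        ≡⟨ adj-pullback σ X i j ⟩
      adj X (lookup σ i) (lookup σ j)   ≡⟨ T-=ᵇ .to (T-∀²ᵇ _ .to X-symmetric (lookup σ i) (lookup σ j)) ⟩
      adj X (lookup σ j) (lookup σ i)   ≡⟨ adj-pullback σ X j i ⟨
      adj σX j i                        ∎)
      where open ≡-Reasoning

    irreflexive : ∀ i j → T ((i =ᶠ j) ⇒ᵇ not (adj σX i j))
    irreflexive i j = T-⇒ᵇ .from λ i=j →
      subst (T ∘ not) (sym (adj-pullback σ X i j))
        (T-⇒ᵇ .to (T-∀²ᵇ _ .to X-irreflexive (lookup σ i) (lookup σ j)) (T-=ᶠ .from (cong (lookup σ) (T-=ᶠ .to i=j))))

  inverse-isPerm : ∀ σ → T (isPerm σ) → T (isPerm (inverse σ))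
  inverse-isPerm σ σ-perm = T-isPerm (inverse σ) .from (inverse-injective σ (T-isPerm σ .to σ-perm))

  ∘ᵐ-isPerm : ∀ σ τ → T (isPerm σ) → T (isPerm τ) → T (isPerm (σ ∘ᵐ τ))
  ∘ᵐ-isPerm σ τ σ-perm τ-perm = T-isPerm (σ ∘ᵐ τ) .from (∘ᵐ-injective σ τ (T-isPerm σ .to σ-perm) (T-isPerm τ .to τ-perm))

  pullback-isomorphic : ∀ σ X → T (isPerm σ) → T (isoᵇ (pullback σ X) X)
  pullback-isomorphic σ X σ-perm = T-isoᵇ (pullback σ X) X .from
    (inverse σ , inverse-isPerm σ σ-perm , pullback-inverse σ (T-isPerm σ .to σ-perm) X)

  ⊆pullback⇒inverse⊆ : ∀ σ → T (isPerm σ) → ∀ H K → T (edgeSub H (pullback σ K)) → T (edgeSub (pullback (inverse σ) H) K)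
  ⊆pullback⇒inverse⊆ σ σ-perm H K H⊆σK = subst (T ∘ edgeSub (pullback (inverse σ) H))
    (pullback-inverse σ (T-isPerm σ .to σ-perm) K) (pullback-edgeSub (inverse σ) H (pullback σ K) H⊆σK)

  pullback⊆⇒⊆inverse : ∀ σ → T (isPerm σ) → ∀ H K → T (edgeSub (pullback σ H) K) → T (edgeSub H (pullback (inverse σ) K))
  pullback⊆⇒⊆inverse σ σ-perm H K σH⊆K = subst (λ H′ → T (edgeSub H′ (pullback (inverse σ) K)))
    (pullback-inverse σ (T-isPerm σ .to σ-perm) H) (pullback-edgeSub (inverse σ) (pullback σ H) K σH⊆K)

  idᵐ-isPerm : T (isPerm idᵐ)
  idᵐ-isPerm = T-isPerm idᵐ .from idᵐ-injective

  isoᵇ-refl : ∀ X → T (isoᵇ X X)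
  isoᵇ-refl X = T-isoᵇ X X .from (idᵐ , idᵐ-isPerm , pullback-idᵐ X)

  autCount-nonZero : ∀ Y → NonZero (autCount Y)
  autCount-nonZero Y = >-nonZero (count-pos (isAut Y) (∈-allPerms idᵐ idᵐ-isPerm) (T-isAut Y idᵐ .from (pullback-idᵐ Y)))

-- Double counting

module _ {n : ℕ} where

  count-isomorphisms : ∀ σ X Y → T (isPerm σ) → pullback σ X ≡ Y →
    count (λ τ → isPerm τ ∧ pullback τ Y == X) (allMaps n) ≡ count (λ α → isPerm α ∧ isAut Y α) (allMaps n)
  count-isomorphisms σ X Y σ-perm σX≡Y =
    count-bijection allMaps-enumerates allMaps-enumerates _ _ (_∘ᵐ σ) (_∘ᵐ σ⁻¹) iso⇒aut aut⇒iso
      (λ τ _ → ∘ᵐ-cancelʳ τ σ σ⁻¹ (inverse-rightInverse σ σ-injective))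
      (λ α _ → ∘ᵐ-cancelʳ α σ⁻¹ σ (inverse-leftInverse σ σ-injective))
    where
    σ⁻¹ = inverse σ
    σ-injective = T-isPerm σ .to σ-perm

    iso⇒aut : ∀ τ → T (isPerm τ ∧ pullback τ Y == X) → T (isPerm (τ ∘ᵐ σ) ∧ isAut Y (τ ∘ᵐ σ))
    iso⇒aut τ t = T-∧ .from (∘ᵐ-isPerm τ σ (T-∧ˡ (isPerm τ) t) σ-perm , T-isAut Y (τ ∘ᵐ σ) .from (begin
      pullback (τ ∘ᵐ σ) Y         ≡⟨ pullback-∘ᵐ τ σ Y ⟩
      pullback σ (pullback τ Y)   ≡⟨ cong (pullback σ) (T-== .to (T-∧ʳ (isPerm τ) t)) ⟩
      pullback σ X                ≡⟨ σX≡Y ⟩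
      Y                           ∎))
      where open ≡-Reasoning

    aut⇒iso : ∀ α → T (isPerm α ∧ isAut Y α) → T (isPerm (α ∘ᵐ σ⁻¹) ∧ pullback (α ∘ᵐ σ⁻¹) Y == X)
    aut⇒iso α t = T-∧ .from (∘ᵐ-isPerm α σ⁻¹ (T-∧ˡ (isPerm α) t) (inverse-isPerm σ σ-perm) , T-== .from (begin
      pullback (α ∘ᵐ σ⁻¹) Y        ≡⟨ pullback-∘ᵐ α σ⁻¹ Y ⟩
      pullback σ⁻¹ (pullback α Y)  ≡⟨ cong (pullback σ⁻¹) (T-isAut Y α .to (T-∧ʳ (isPerm α) t)) ⟩
      pullback σ⁻¹ Y               ≡⟨ cong (pullback σ⁻¹) σX≡Y ⟨
      pullback σ⁻¹ (pullback σ X)  ≡⟨ pullback-inverse σ σ-injective X ⟩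
      X                            ∎))
      where open ≡-Reasoning

  count-relabellings : ∀ Y → T (isSimple Y) → (R : Mat n → Bool) →
    count (λ τ → R (pullback τ Y)) (allPerms n) ≡ count (λ X → R X ∧ isoᵇ X Y) (allGraphs n) * autCount Y
  count-relabellings Y Y-simple R = begin
    count (λ τ → R (pullback τ Y)) (allPerms n)
      ≡⟨ count-filter isPerm _ (allMaps n) ⟩
    count (λ τ → isPerm τ ∧ R (pullback τ Y)) (allMaps n)
      ≡⟨ count-fibres (allMaps n) matrices-enumerate (λ τ → pullback τ Y) _ _ _ relabelling-isomorphic fibre-size ⟩
    count (λ X → isSimple X ∧ (R X ∧ isoᵇ X Y)) (allMatrices n) * count (λ α → isPerm α ∧ isAut Y α) (allMaps n)
      ≡⟨ cong₂ _*_ (count-filter isSimple _ (allMatrices n)) (count-filter isPerm (isAut Y) (allMaps n)) ⟨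
    count (λ X → R X ∧ isoᵇ X Y) (allGraphs n) * autCount Y
      ∎
    where
    open ≡-Reasoning

    relabelling-isomorphic : ∀ τ → T (isPerm τ ∧ R (pullback τ Y)) →
                             T (isSimple (pullback τ Y) ∧ (R (pullback τ Y) ∧ isoᵇ (pullback τ Y) Y))
    relabelling-isomorphic τ t = T-∧ .from (pullback-simple τ Y Y-simple ,
      T-∧ .from (T-∧ʳ (isPerm τ) t , pullback-isomorphic τ Y (T-∧ˡ (isPerm τ) t)))

    fibre-size : ∀ X → T (isSimple X ∧ (R X ∧ isoᵇ X Y)) →
      count (λ τ → (isPerm τ ∧ R (pullback τ Y)) ∧ pullback τ Y == X) (allMaps n) ≡
      count (λ α → isPerm α ∧ isAut Y α) (allMaps n)
    fibre-size X t with T-isoᵇ X Y .to (T-∧ʳ (R X) (T-∧ʳ (isSimple X) t))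
    ... | σ , σ-perm , σX≡Y = trans (count-cong (allMaps n) λ {τ} _ → R-redundant τ) (count-isomorphisms σ X Y σ-perm σX≡Y)
      where
      R-X : T (R X)
      R-X = T-∧ˡ (R X) (T-∧ʳ (isSimple X) t)
      R-redundant : ∀ τ → T ((isPerm τ ∧ R (pullback τ Y)) ∧ pullback τ Y == X) ⇔ T (isPerm τ ∧ pullback τ Y == X)
      R-redundant τ = ∧-implied (isPerm τ) (R (pullback τ Y)) (pullback τ Y == X)
                        λ τY==X → subst (T ∘ R) (sym (T-== .to τY==X)) R-X

  count-pullback-edgeSub : ∀ U G →
    count (λ τ → edgeSub U (pullback τ G)) (allPerms n) ≡ count (λ ρ → edgeSub (pullback ρ U) G) (allPerms n)
  count-pullback-edgeSub U G = begin
    count (λ τ → edgeSub U (pullback τ G)) (allPerms n)           ≡⟨ count-filter isPerm _ (allMaps n) ⟩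
    count (λ τ → isPerm τ ∧ edgeSub U (pullback τ G)) (allMaps n)  ≡⟨ inversion ⟩
    count (λ ρ → isPerm ρ ∧ edgeSub (pullback ρ U) G) (allMaps n)  ≡⟨ count-filter isPerm _ (allMaps n) ⟨
    count (λ ρ → edgeSub (pullback ρ U) G) (allPerms n)           ∎
    where
    open ≡-Reasoning
    inversion = count-bijection allMaps-enumerates allMaps-enumerates _ _ inverse inverse
      (λ τ t → T-∧ .from (inverse-isPerm τ (T-∧ˡ (isPerm τ) t) ,
                          ⊆pullback⇒inverse⊆ τ (T-∧ˡ (isPerm τ) t) U G (T-∧ʳ (isPerm τ) t)))
      (λ ρ t → T-∧ .from (inverse-isPerm ρ (T-∧ˡ (isPerm ρ) t) ,
                          pullback⊆⇒⊆inverse ρ (T-∧ˡ (isPerm ρ) t) U G (T-∧ʳ (isPerm ρ) t)))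
      (λ τ t → inverse-involutive τ (T-isPerm τ .to (T-∧ˡ (isPerm τ) t)))
      (λ ρ t → inverse-involutive ρ (T-isPerm ρ .to (T-∧ˡ (isPerm ρ) t)))

xCount*autCount≡sCount*autCount : ∀ {n} (G U : Mat n) → T (isSimple G) → T (isSimple U) →
                                  xCount U G * autCount G ≡ sCount U G * autCount U
xCount*autCount≡sCount*autCount {n} G U G-simple U-simple = begin
  xCount U G * autCount G                              ≡⟨ count-relabellings G G-simple (edgeSub U) ⟨
  count (λ τ → edgeSub U (pullback τ G)) (allPerms n)  ≡⟨ count-pullback-edgeSub U G ⟩
  count (λ ρ → edgeSub (pullback ρ U) G) (allPerms n)  ≡⟨ count-relabellings U U-simple (λ H → edgeSub H G) ⟩
  sCount U G * autCount U                              ∎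
  where open ≡-Reasoning

cross-multiply : ∀ x g s u c .{{_ : NonZero g}} → x * g ≡ s * u → s * c ≡ g → x * c ≡ u
cross-multiply x g s u c xg≡su sc≡g = *-cancelʳ-≡ (x * c) u g (begin
  x * c * g ≡⟨ xy∙z≈xz∙y x c g ⟩
  x * g * c ≡⟨ cong (_* c) xg≡su ⟩
  s * u * c ≡⟨ xy∙z≈xz∙y s u c ⟩
  s * c * u ≡⟨ cong (_* u) sc≡g ⟩
  g * u     ≡⟨ *-comm g u ⟩
  u * g     ∎)
  where open ≡-Reasoning

module _ {n : ℕ} (G : Mat n) (G-simple : T (isSimple G)) where

  fixing⇔xCount*autCapCount≡autCount : ∀ U → T (isSimple U) →
                                       Fixing U G ⇔ (xCount U G * autCapCount U G ≡ autCount U)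
  fixing⇔xCount*autCapCount≡autCount U U-simple = mk⇔
    (cross-multiply (xCount U G) (autCount G) (sCount U G) (autCount U) (autCapCount U G) {{autCount-nonZero G}} counted-twice)
    (cross-multiply (sCount U G) (autCount U) (xCount U G) (autCount G) (autCapCount U G) {{autCount-nonZero U}} (sym counted-twice))
    where counted-twice = xCount*autCount≡sCount*autCount G U G-simple U-simple

  autCapCount≡autCount : ∀ U → AutSub U G → autCapCount U G ≡ autCount U
  autCapCount≡autCount U A[U]⊆A[G] = count-cong (allPerms n) λ {σ} σ∈perms →
    mk⇔ (T-∧ˡ (isAut U σ))
        (λ σ-aut → T-∧ .from (σ-aut , A[U]⊆A[G] σ (proj₂ (∈-filter⁻ (T? ∘ isPerm) {xs = allMaps n} σ∈perms)) σ-aut))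

  xCount≡1⇒AutSub : ∀ U → T (edgeSub U G) → xCount U G ≡ 1 → AutSub U G
  xCount≡1⇒AutSub U U⊆G one σ σ-perm σ-aut = T-isAut G σ .from
    (count≡1⇒unique (λ X → edgeSub U X ∧ isoᵇ X G) one
       (∈-allGraphs (pullback σ G) (pullback-simple σ G G-simple)) (∈-allGraphs G G-simple)
       (T-∧ .from (U⊆σG , pullback-isomorphic σ G σ-perm)) (T-∧ .from (U⊆G , isoᵇ-refl G)))
    where
    U⊆σG : T (edgeSub U (pullback σ G))
    U⊆σG = subst (λ H → T (edgeSub H (pullback σ G))) (T-isAut U σ .to σ-aut) (pullback-edgeSub σ U G U⊆G)

  strongFixing⇔xCount≡1 : ∀ U → T (isSimple U) → T (edgeSub U G) → StrongFixing U G ⇔ (xCount U G ≡ 1)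
  strongFixing⇔xCount≡1 U U-simple U⊆G = mk⇔ strong⇒one one⇒strong
    where
    open ≡-Reasoning
    strong⇒one : StrongFixing U G → xCount U G ≡ 1
    strong⇒one (fixing , A[U]⊆A[G]) = *-cancelʳ-≡ (xCount U G) 1 (autCount U) {{autCount-nonZero U}} (begin
      xCount U G * autCount U      ≡⟨ cong (xCount U G *_) (autCapCount≡autCount U A[U]⊆A[G]) ⟨
      xCount U G * autCapCount U G ≡⟨ fixing⇔xCount*autCapCount≡autCount U U-simple .to fixing ⟩
      autCount U                   ≡⟨ *-identityˡ (autCount U) ⟨
      1 * autCount U               ∎)

    one⇒strong : xCount U G ≡ 1 → StrongFixing U G
    one⇒strong one = fixing⇔xCount*autCapCount≡autCount U U-simple .from (begin
      xCount U G * autCapCount U G ≡⟨ cong₂ _*_ one (autCapCount≡autCount U A[U]⊆A[G]) ⟩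
      1 * autCount U               ≡⟨ *-identityˡ (autCount U) ⟩
      autCount U                   ∎) , A[U]⊆A[G]
      where A[U]⊆A[G] = xCount≡1⇒AutSub U U⊆G one

  strongFixing-superset : ∀ U → T (isSimple U) → T (edgeSub U G) → StrongFixing U G →
                          ∀ K → T (isSimple K) → T (edgeSub K G) → T (edgeSub U K) → AutSub K G × StrongFixing K G
  strongFixing-superset U U-simple U⊆G U-strong K K-simple K⊆G U⊆K = proj₂ K-strong , K-strong
    where
    xCount-antitone : xCount K G ≤ xCount U G
    xCount-antitone = count-mono (allGraphs n) λ {X} _ t →
      T-∧ .from (edgeSub-trans U K X U⊆K (T-∧ˡ (edgeSub K X) t) , T-∧ʳ (edgeSub K X) t)
    G-counted : 1 ≤ xCount K G
    G-counted = count-pos (λ X → edgeSub K X ∧ isoᵇ X G) (∈-allGraphs G G-simple) (T-∧ .from (K⊆G , isoᵇ-refl G))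
    K-strong : StrongFixing K G
    K-strong = strongFixing⇔xCount≡1 K K-simple K⊆G .from
      (≤-antisym (subst (xCount K G ≤_) (strongFixing⇔xCount≡1 U U-simple U⊆G .to U-strong) xCount-antitone) G-counted)

theorem5 : (n : ℕ) (G U : Mat n) → T (isSimple G) → T (isSimple U) → T (edgeSub U G) →
    (Fixing U G ⇔ (xCount U G * autCapCount U G ≡ autCount U))
    × (StrongFixing U G ⇔ (xCount U G ≡ 1))
    × (StrongFixing U G → (K : Mat n) → T (isSimple K) → T (edgeSub K G) → T (edgeSub U K) →
        AutSub K G × StrongFixing K G)
theorem5 n G U G-simple U-simple U⊆G =
  fixing⇔xCount*autCapCount≡autCount G G-simple U U-simple ,
  strongFixing⇔xCount≡1 G G-simple U U-simple U⊆G ,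
  strongFixing-superset G G-simple U U-simple U⊆G
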